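{- Let $G$ and $H$ be graphs with $G$ connected and $V(G)=\{v_1,\dots,v_n\}$, and let $S$ be a distance-equalizer set of $G\odot H$ of minimum cardinality $\xi(G\odot H)$ such that for every $i$, either $V(H_i)\cap S=\varnothing$ or $V(H_i)\subseteq S$. If $\mathrm{n}(H)>\min\{\alpha(\widehat{G}),\ \beta(\widehat{G})-\beta^*(G)+1\}$, then $U(S)=\{v_i\in V(G): V(H_i)\cap S\neq\varnothing\}$ is a vertex cover of $\widehat{G}$ of cardinality $\beta(\widehat{G})$.
   Context: All graphs are finite, simple and undirected; $\mathrm{n}(H)$ denotes the order of $H$. For a connected graph $\Gamma$, a set $S\subseteq V(\Gamma)$ is a distance-equalizer set if for every two distinct $u,v\in V(\Gamma)\setminus S$ there is $w\in S$ with $d_\Gamma(w,u)=d_\Gamma(w,v)$; $\xi(\Gamma)$ is the minimum cardinality of such a set. The corona product $G\odot H$ is obtained from $G$ and $n$ pairwise disjoint copies $H_1,\dots,H_n$ of $H$ by joining $v_i$ to every vertex of $H_i$. The empty bisector graph $\widehat{G}$ has vertex set $V(G)$, with distinct $u,v$ adjacent iff there is no $w\in V(G)$ with $d_G(w,u)=d_G(w,v)$. $\alpha$ denotes the independence number and $\beta$ the vertex cover number. A pair $(X,Y)$ of subsets of $V(G)$ with $X\cup Y=V(G)$ is a forward-equalized pair of $G$ if for every $(u,v)\in (X\setminus Y)\times(Y\setminus X)$ there exists $w\in V(G)$ with $d_G(w,u)=d_G(w,v)+1$. $\beta^*(G)=\min\{|X\cap Y| : X,Y \text{ vertex covers of }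 \widehat{G},\ (X,Y) \text{ a forward-equalized pair of } G\}$. -}

module Defs where

open import Data.Nat using (ℕ; zero; suc; _+_; _*_; _≤_)
open import Data.Bool using (Bool; true; false; T; _∧_)
open import Data.Fin using (Fin; splitAt; remQuot; combine; _↑ˡ_; _↑ʳ_; _≟_)
open import Data.Fin.Subset using (Subset; _∈_; _∉_; ∣_∣; _∩_; _∪_; ⊤; _─_)
open import Data.Vec using (tabulate)
open import Data.List using (allFin)
open import Data.Bool.ListAction using (any)
open import Data.Sum using (_⊎_; inj₁; inj₂)
open import Data.Product using (_×_; _,_; ∃; ∃-syntax)
open import Relation.Nullary using (¬_; ⌊_⌋)
open import Relation.Binary.PropositionalEquality using (_≡_; _≢_)

record Graph (n : ℕ) : Set where
  field
    adj     : Fin n → Fin n → Bool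
    adj-sym : ∀ u v → adj u v ≡ adj v u
    irrefl  : ∀ u → adj u u ≡ false
open Graph public

data Walk {n : ℕ} (A : Fin n → Fin n → Bool) : Fin n → Fin n → ℕ → Set where
  here : ∀ {u} → Walk A u u zero
  step : ∀ {u w v k} → T (A u w) → Walk A w v k → Walk A u v (suc k)

Dist : ∀ {n} → (Fin n → Fin n → Bool) → Fin n → Fin n → ℕ → Set
Dist A u v k = Walk A u v k × (∀ m → Walk A u v m → k ≤ m)

Connected : ∀ {n} → Graph n → Set
Connected {n} G = ∀ (u v : Fin n) → ∃[ k ] Walk (adj G) u v k

Equidist : ∀ {n} → (Fin n → Fin n → Bool) → Fin n → Fin n → Fin n → Set
Equidist A w u v = ∃[ k ] (Dist A w u k × Dist A w v k)

IsDistEqualizer : ∀ {n} → (Fin n → Fin n → Bool) → Subset n → Set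
IsDistEqualizer {n} A S =
  ∀ (u v : Fin n) → u ≢ v → u ∉ S → v ∉ S → ∃[ w ] (w ∈ S × Equidist A w u v)

IsMinDistEqualizer : ∀ {n} → (Fin n → Fin n → Bool) → Subset n → Set
IsMinDistEqualizer {n} A S =
  IsDistEqualizer A S × (∀ (T : Subset n) → IsDistEqualizer A T → ∣ S ∣ ≤ ∣ T ∣)

-- Corona product G ⊙ H, vertex set Fin (n + n * m):
--   v_i         ↦ i ↑ˡ (n * m)
--   a-th vertex of H_i ↦ n ↑ʳ combine i a
gVtx : ∀ {n} m → Fin n → Fin (n + n * m)
gVtx {n} m i = i ↑ˡ (n * m)

hVtx : ∀ {n m} → Fin n → Fin m → Fin (n + n * m)
hVtx {n} {m} i a = n ↑ʳ combine i a

coronaAdj : ∀ {n m} → Graph n → Graph m → Fin (n + n * m) → Fin (n + n * m) → Bool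
coronaAdj {n} {m} G H x y with splitAt n x | splitAt n y
... | inj₁ i | inj₁ j = adj G i j
... | inj₁ i | inj₂ l with remQuot {n} m l
...   | (j , _) = ⌊ i ≟ j ⌋
coronaAdj {n} {m} G H x y | inj₂ k | inj₁ j with remQuot {n} m k
...   | (i , _) = ⌊ i ≟ j ⌋
coronaAdj {n} {m} G H x y | inj₂ k | inj₂ l with remQuot {n} m k | remQuot {n} m l
...   | (i , a) | (j , b) = ⌊ i ≟ j ⌋ ∧ adj H a b

BisAdj : ∀ {n} → Graph n → Fin n → Fin n → Set
BisAdj {n} G u v = u ≢ v × ¬ (∃[ w ] Equidist (adj G) w u v)

IsVertexCover : ∀ {n} → (Fin n → Fin n → Set) → Subset n → Set
IsVertexCover R C = ∀ u v → R u v → u ∈ C ⊎ v ∈ C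

IsIndependent : ∀ {n} → (Fin n → Fin n → Set) → Subset n → Set
IsIndependent R I = ∀ u v → u ∈ I → v ∈ I → ¬ R u v

IsIndependenceNumber : ∀ {n} → (Fin n → Fin n → Set) → ℕ → Set
IsIndependenceNumber {n} R a =
  (∃[ I ] (IsIndependent R I × ∣ I ∣ ≡ a)) × (∀ (I : Subset n) → IsIndependent R I → ∣ I ∣ ≤ a)

IsVertexCoverNumber : ∀ {n} → (Fin n → Fin n → Set) → ℕ → Set
IsVertexCoverNumber {n} R b =
  (∃[ C ] (IsVertexCover R C × ∣ C ∣ ≡ b)) × (∀ (C : Subset n) → IsVertexCover R C → b ≤ ∣ C ∣)

ForwardEqualized : ∀ {n} → Graph n → Subset n → Subset n → Set
ForwardEqualized {n} G X Y =
  X ∪ Y ≡ ⊤ ×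
  (∀ (u v : Fin n) → u ∈ X ─ Y → v ∈ Y ─ X →
     ∃[ w ] ∃[ k ] (Dist (adj G) w u (suc k) × Dist (adj G) w v k))

AdmissiblePair : ∀ {n} → Graph n → Subset n → Subset n → Set
AdmissiblePair G X Y =
  IsVertexCover (BisAdj G) X × IsVertexCover (BisAdj G) Y × ForwardEqualized G X Y

IsBetaStar : ∀ {n} → Graph n → ℕ → Set
IsBetaStar {n} G c =
  (∃[ X ] ∃[ Y ] (AdmissiblePair G X Y × ∣ X ∩ Y ∣ ≡ c)) ×
  (∀ (X Y : Subset n) → AdmissiblePair G X Y → c ≤ ∣ X ∩ Y ∣)

U : ∀ {n m} → Subset (n + n * m) → Subset n
U {n} {m} S = tabulate λ i → any (λ a → Data.Vec.lookup S (hVtx {n} {m} i a)) (allFin m)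

-- Every vertex of G ⊙ H is v_i (depth 0) or a vertex of H_i (depth 1), with root v_i, and
-- between different roots the distance is the G-distance of the roots plus both depths. So a
-- vertex of S equalizing two vertices either lies in the copy {v_i} ∪ V(H_i) of one of them,
-- which the hypotheses on S rule out or control, or its root equalizes (or is one step closer
-- to one of) their roots in G. This makes U = U(S) and Sᴳ = S ∩ V(G) vertex covers of the empty
-- bisector graph with U ∪ Sᴳ = V(G) and (U, Sᴳ) forward-equalized, whence β* ≤ ∣ U ∩ Sᴳ ∣ and
-- n − ∣ Sᴳ ∣ ≤ α. Conversely V(G) together with the copies of H over a minimum vertex cover is a
-- distance-equalizer set, so minimality gives ∣ Sᴳ ∣ + n(H) ∣ U ∣ ≤ n + n(H) β. If ∣ U ∣ > β these
-- inequalities force n(H) ≤ α and n(H) ≤ β − β* + 1, contradicting the hypothesis.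

{-# OPTIONS --safe #-}
module Submission where

open import Defs
open import Data.Bool using (Bool; false; T; _∧_)
open import Data.Bool.Properties using (T-≡; T-∧; ¬-not)
open import Data.Empty using (⊥-elim)
open import Data.Fin using (Fin; _≟_; fromℕ<; splitAt; remQuot; combine; join; _↑ʳ_)
open import Data.Fin.Properties using (any?; splitAt-↑ˡ; splitAt-↑ʳ; remQuot-combine; combine-remQuot; join-splitAt)
open import Data.Fin.Subset using (Subset; inside; outside; _∈_; _∉_; ∣_∣; _∩_; _∪_; ⊤; _─_; ∁)
open import Data.Fin.Subset.Properties using (_∈?_; ∈⊤; ⊆⊤; ⊆-antisym; p─q⊆p; ∣⊤∣≡n; ∣⊥∣≡0; ∣∁p∣≡n∸∣p∣; x∈p∪q⁺; x∈∁p⇒x∉p)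
open import Data.List using (allFin)
open import Data.List.Membership.Propositional using (lose)
open import Data.List.Membership.Propositional.Properties using (∈-allFin)
open import Data.List.Relation.Unary.Any using (satisfied)
open import Data.List.Relation.Unary.Any.Properties using (any⁺; any⁻)
open import Data.Nat using (ℕ; zero; suc; _+_; _*_; _∸_; _⊓_; _≤_; _<_; z≤n; s≤s; s≤s⁻¹)
open import Data.Nat.Properties hiding (_≟_)
open import Data.Product using (_×_; _,_; ∃; ∃-syntax; ∃₂; proj₁; proj₂; uncurry)
open import Data.Sum using (_⊎_; inj₁; inj₂; [_,_])
open import Data.Vec using (Vec; []; _∷_; _++_; lookup; tabulate; replicate; concat; map; here; there)
open import Data.Vec.Properties using ([]=⇒lookup; lookup⇒[]=; lookup∘tabulate; lookup-++ˡ; lookup-++ʳ; lookup-concat; lookup-map; lookup-replicate)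
open import Data.Vec.Relation.Binary.Pointwise.Extensional using (ext; Pointwise-≡⇒≡)
open import Function using (id; _∘_; Equivalence; case_of_)
open import Relation.Nullary using (¬_; Dec; yes; no; ⌊_⌋; contradiction)
open import Relation.Nullary.Decidable using (T?; _×-dec_; toWitness; fromWitness)
open import Relation.Unary using (Pred; Decidable)
open import Relation.Binary.PropositionalEquality using (_≡_; _≢_; refl; sym; trans; cong; cong₂; subst; subst₂; module ≡-Reasoning)

least-witness : ∀ {p} {P : Pred ℕ p} → Decidable P → ∀ {k} → P k → ∃[ d ] (P d × ∀ j → P j → d ≤ j)
least-witness {P = P} P? {k} pk = [ (λ none → contradiction pk (none k ≤-refl)) , id ] (search (suc k))
  where
  search : ∀ k → (∀ j → j < k → ¬ P j) ⊎ ∃[ d ] (P d × ∀ j → P j → d ≤ j)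
  search zero = inj₁ λ _ ()
  search (suc k) with search k
  ... | inj₂ least = inj₂ least
  ... | inj₁ none-below with P? k
  ...   | yes pk = inj₂ (k , pk , λ j pj → ≮⇒≥ λ j<k → none-below j j<k pj)
  ...   | no ¬pk = inj₁ λ j j<1+k → not-at-or-below (m≤n⇒m<n∨m≡n (s≤s⁻¹ j<1+k))
    where
    not-at-or-below : ∀ {j} → j < k ⊎ j ≡ k → ¬ P j
    not-at-or-below (inj₁ j<k) = none-below _ j<k
    not-at-or-below (inj₂ refl) = ¬pk

-- In the application s = ∣ S ∩ V(G) ∣, u = ∣ U(S) ∣ and i = ∣ U(S) ∩ S ∩ V(G) ∣.
excess-bound : ∀ {n m s u i α β β*} → s + m * u ≤ n + m * β → i + n ≡ u + s → n ∸ s ≤ α → β* ≤ i →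
               α ⊓ (β ∸ β* + 1) < m → u ≤ β
excess-bound {m = zero} _ _ _ _ ()
excess-bound {n} {m@(suc _)} {s} {u} {i} {α} {β} {β*} size inclusion-exclusion ∁-bound β*≤i min<m =
  ≮⇒≥ λ β<u → <-irrefl refl (<-≤-trans min<m (⊓-glb (m≤α β<u) (m≤β∸β*+1 β<u)))
  where
  module Excess (β<u : β < u) where
    t : ℕ
    t = proj₁ (m≤n⇒∃[o]m+o≡n β<u)

    u≡β+[1+t] : u ≡ β + suc t
    u≡β+[1+t] = trans (sym (proj₂ (m≤n⇒∃[o]m+o≡n β<u))) (sym (+-suc β t))

    s+m[1+t]≤n : s + m * suc t ≤ n
    s+m[1+t]≤n = +-cancelʳ-≤ (m * β) _ _ (begin
      s + m * suc t + m * β   ≡⟨ +-assoc s _ _ ⟩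
      s + (m * suc t + m * β) ≡⟨ cong (s +_) (+-comm (m * suc t) (m * β)) ⟩
      s + (m * β + m * suc t) ≡⟨ cong (s +_) (*-distribˡ-+ m β (suc t)) ⟨
      s + m * (β + suc t)     ≡⟨ cong (λ x → s + m * x) u≡β+[1+t] ⟨
      s + m * u               ≤⟨ size ⟩
      n + m * β               ∎)
      where open ≤-Reasoning

    i+m[1+t]≤β+[1+t] : i + m * suc t ≤ β + suc t
    i+m[1+t]≤β+[1+t] = +-cancelʳ-≤ s _ _ (begin
      i + m * suc t + s   ≡⟨ +-assoc i _ s ⟩
      i + (m * suc t + s) ≡⟨ cong (i +_) (+-comm (m * suc t) s) ⟩
      i + (s + m * suc t) ≤⟨ +-monoʳ-≤ i s+m[1+t]≤n ⟩
      i + n               ≡⟨ inclusion-exclusion ⟩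
      u + s               ≡⟨ cong (_+ s) u≡β+[1+t] ⟩
      β + suc t + s       ∎)
      where open ≤-Reasoning

    β*+m≤1+β : β* + m ≤ suc β
    β*+m≤1+β = +-cancelʳ-≤ t _ _ (begin
      β* + m + t       ≡⟨ +-assoc β* m t ⟩
      β* + (m + t)     ≤⟨ +-mono-≤ β*≤i (+-monoʳ-≤ m (m≤n*m t m)) ⟩
      i + (m + m * t)  ≡⟨ cong (i +_) (*-suc m t) ⟨
      i + m * suc t    ≤⟨ i+m[1+t]≤β+[1+t] ⟩
      β + suc t        ≡⟨ +-suc β t ⟩
      suc β + t        ∎)
      where open ≤-Reasoning

  m≤α : β < u → m ≤ α
  m≤α β<u = begin
    m             ≤⟨ m≤m*n m (suc t) ⟩
    m * suc t     ≤⟨ m+n≤o⇒m≤o∸n (m * suc t) (subst (_≤ n) (+-comm s _) s+m[1+t]≤n) ⟩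
    n ∸ s         ≤⟨ ∁-bound ⟩
    α             ∎
    where open Excess β<u
          open ≤-Reasoning

  m≤β∸β*+1 : β < u → m ≤ β ∸ β* + 1
  m≤β∸β*+1 β<u = +-cancelˡ-≤ β* _ _ (begin
    β* + m                ≤⟨ β*+m≤1+β ⟩
    suc β                 ≤⟨ s≤s (m≤n+m∸n β β*) ⟩
    suc (β* + (β ∸ β*))   ≡⟨ +-suc β* (β ∸ β*) ⟨
    β* + suc (β ∸ β*)     ≡⟨ cong (β* +_) (+-comm 1 (β ∸ β*)) ⟩
    β* + (β ∸ β* + 1)     ∎)
    where open Excess β<u
          open ≤-Reasoning

module _ {n : ℕ} {A : Fin n → Fin n → Bool} where

  _++ʷ_ : ∀ {u v w k l} → Walk A u v k → Walk A v w l → Walk A u w (k + l)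
  here ++ʷ q = q
  step e p ++ʷ q = step e (p ++ʷ q)

  walk-zero⇒≡ : ∀ {u v} → Walk A u v 0 → u ≡ v
  walk-zero⇒≡ here = refl

  Dist-unique : ∀ {u v k l} → Dist A u v k → Dist A u v l → k ≡ l
  Dist-unique (p , p-min) (q , q-min) = ≤-antisym (p-min _ q) (q-min _ p)

  Dist-refl : ∀ {u} → Dist A u u 0
  Dist-refl = here , λ _ _ → z≤n

  Dist-adjacent : ∀ {u v} → u ≢ v → T (A u v) → Dist A u v 1
  Dist-adjacent u≢v e = step e here , λ where
    zero p → contradiction (walk-zero⇒≡ p) u≢v
    (suc _) _ → s≤s z≤n

  Equidist-sym : ∀ {w u v} → Equidist A w u v → Equidist A w v u
  Equidist-sym (k , Du , Dv) = k , Dv , Du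

  equidistant⇒≢ : ∀ {w u v k} → u ≢ v → Dist A w u k → Dist A w v k → w ≢ u
  equidistant⇒≢ u≢v Du Dv refl with Dist-unique Du Dist-refl
  ... | refl = u≢v (walk-zero⇒≡ (proj₁ Dv))

module _ {n : ℕ} (A : Fin n → Fin n → Bool) where

  walk? : ∀ k u v → Dec (Walk A u v k)
  walk? zero u v with u ≟ v
  ... | yes refl = yes here
  ... | no u≢v = no λ { here → u≢v refl }
  walk? (suc k) u v with any? (λ w → T? (A u w) ×-dec walk? k w v)
  ... | yes (w , e , p) = yes (step e p)
  ... | no none = no λ { (step e p) → none (_ , e , p) }

  walk⇒Dist : ∀ {u v k} → Walk A u v k → ∃ (Dist A u v)
  walk⇒Dist {u} {v} p = least-witness (λ k → walk? k u v) p

  equidistant? : (∀ u v → ∃ (Walk A u v)) → ∀ w u v → Dec (Equidist A w u v)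
  equidistant? connected w u v
    with walk⇒Dist (proj₂ (connected w u)) | walk⇒Dist (proj₂ (connected w v))
  ... | k , Du | l , Dv with k Data.Nat.≟ l
  ...   | yes refl = yes (k , Du , Dv)
  ...   | no k≢l = no λ (j , Du′ , Dv′) → k≢l (trans (Dist-unique Du Du′) (Dist-unique Dv′ Dv))

∈-resp-lookup : ∀ {k l} {p : Subset k} {q : Subset l} {x y} → lookup p x ≡ lookup q y → x ∈ p → y ∈ q
∈-resp-lookup {q = q} {y = y} same x∈p = lookup⇒[]= y q (trans (sym same) ([]=⇒lookup x∈p))

∉⇒lookup≡false : ∀ {k} {p : Subset k} {x} → x ∉ p → lookup p x ≡ false
∉⇒lookup≡false {p = p} {x} x∉p = ¬-not (x∉p ∘ lookup⇒[]= x p)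

x∈p─q⇒x∉q : ∀ {k} (p q : Subset k) {x} → x ∈ p ─ q → x ∉ q
x∈p─q⇒x∉q (_ ∷ p) (inside ∷ q) () here
x∈p─q⇒x∉q (_ ∷ p) (_ ∷ q) (there x∈p─q) (there x∈q) = x∈p─q⇒x∉q p q x∈p─q x∈q

∣p∩q∣+∣p∪q∣≡∣p∣+∣q∣ : ∀ {k} (p q : Subset k) → ∣ p ∩ q ∣ + ∣ p ∪ q ∣ ≡ ∣ p ∣ + ∣ q ∣
∣p∩q∣+∣p∪q∣≡∣p∣+∣q∣ [] [] = refl
∣p∩q∣+∣p∪q∣≡∣p∣+∣q∣ (inside ∷ p) (inside ∷ q) =
  cong suc (trans (+-suc _ _) (trans (cong suc (∣p∩q∣+∣p∪q∣≡∣p∣+∣q∣ p q)) (sym (+-suc _ _))))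
∣p∩q∣+∣p∪q∣≡∣p∣+∣q∣ (inside ∷ p) (outside ∷ q) = trans (+-suc _ _) (cong suc (∣p∩q∣+∣p∪q∣≡∣p∣+∣q∣ p q))
∣p∩q∣+∣p∪q∣≡∣p∣+∣q∣ (outside ∷ p) (inside ∷ q) =
  trans (+-suc _ _) (trans (cong suc (∣p∩q∣+∣p∪q∣≡∣p∣+∣q∣ p q)) (sym (+-suc _ _)))
∣p∩q∣+∣p∪q∣≡∣p∣+∣q∣ (outside ∷ p) (outside ∷ q) = ∣p∩q∣+∣p∪q∣≡∣p∣+∣q∣ p q

∁-of-cover-independent : ∀ {k} {R : Fin k → Fin k → Set} {C} → IsVertexCover R C → IsIndependent R (∁ C)
∁-of-cover-independent C-covers u v u∈∁C v∈∁C uRv = [ x∈∁p⇒x∉p u∈∁C , x∈∁p⇒x∉p v∈∁C ] (C-covers u v uRv)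

∣p++q∣≡∣p∣+∣q∣ : ∀ {k l} (p : Subset k) (q : Subset l) → ∣ p ++ q ∣ ≡ ∣ p ∣ + ∣ q ∣
∣p++q∣≡∣p∣+∣q∣ [] q = refl
∣p++q∣≡∣p∣+∣q∣ (inside ∷ p) q = cong suc (∣p++q∣≡∣p∣+∣q∣ p q)
∣p++q∣≡∣p∣+∣q∣ (outside ∷ p) q = ∣p++q∣≡∣p∣+∣q∣ p q

∣concat-replicate∣ : ∀ {n} m (L : Subset n) → ∣ concat (map (replicate m) L) ∣ ≡ m * ∣ L ∣
∣concat-replicate∣ m [] = sym (*-zeroʳ m)
∣concat-replicate∣ m (inside ∷ L) = begin
  ∣ replicate m inside ++ concat (map (replicate m) L) ∣ ≡⟨ ∣p++q∣≡∣p∣+∣q∣ (replicate m inside) _ ⟩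
  ∣ ⊤ {m} ∣ + ∣ concat (map (replicate m) L) ∣         ≡⟨ cong₂ _+_ (∣⊤∣≡n m) (∣concat-replicate∣ m L) ⟩
  m + m * ∣ L ∣                                         ≡⟨ *-suc m ∣ L ∣ ⟨
  m * suc ∣ L ∣                                         ∎
  where open ≡-Reasoning
∣concat-replicate∣ m (outside ∷ L) = begin
  ∣ replicate m outside ++ concat (map (replicate m) L) ∣  ≡⟨ ∣p++q∣≡∣p∣+∣q∣ (replicate m outside) _ ⟩
  ∣ replicate m outside ∣ + ∣ concat (map (replicate m) L) ∣ ≡⟨ cong₂ _+_ (∣⊥∣≡0 m) (∣concat-replicate∣ m L) ⟩
  m * ∣ L ∣                                                ∎
  where open ≡-Reasoning

module CoronaVertices (n m : ℕ) where

  data Vertex : Set where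
    base : Fin n → Vertex
    leaf : Fin n → Fin m → Vertex

  enc : Vertex → Fin (n + n * m)
  enc (base i) = gVtx m i
  enc (leaf i a) = hVtx i a

  dec : Fin (n + n * m) → Vertex
  dec x with splitAt n x
  ... | inj₁ i = base i
  ... | inj₂ k = uncurry leaf (remQuot {n} m k)

  dec-enc : ∀ p → dec (enc p) ≡ p
  dec-enc (base i) rewrite splitAt-↑ˡ n i (n * m) = refl
  dec-enc (leaf i a) rewrite splitAt-↑ʳ n (n * m) (combine i a) = cong (uncurry leaf) (remQuot-combine i a)

  enc-dec : ∀ x → enc (dec x) ≡ x
  enc-dec x with splitAt n x in eq
  ... | inj₁ i = trans (cong (join n (n * m)) (sym eq)) (join-splitAt n (n * m) x)
  ... | inj₂ k = trans (cong (n ↑ʳ_) (combine-remQuot {n} m k))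
                       (trans (cong (join n (n * m)) (sym eq)) (join-splitAt n (n * m) x))

  enc-injective : ∀ {p q} → enc p ≡ enc q → p ≡ q
  enc-injective {p} {q} e = trans (sym (dec-enc p)) (trans (cong dec e) (dec-enc q))

  data View : Fin (n + n * m) → Set where
    ⟨_⟩ : ∀ p → View (enc p)

  view : ∀ x → View x
  view x = subst View (enc-dec x) ⟨ dec x ⟩

  root : Vertex → Fin n
  root (base i) = i
  root (leaf i _) = i

  depth : Vertex → ℕ
  depth (base _) = 0
  depth (leaf _ _) = 1

  depth≤1 : ∀ p → depth p ≤ 1
  depth≤1 (base _) = z≤n
  depth≤1 (leaf _ _) = s≤s z≤n

  enc-ext : ∀ {A : Set} {xs ys : Vec A (n + n * m)} → (∀ p → lookup xs (enc p) ≡ lookup ys (enc p)) → xs ≡ ys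
  enc-ext {xs = xs} {ys} same = Pointwise-≡⇒≡ (ext pointwise)
    where
    pointwise : ∀ x → lookup xs x ≡ lookup ys x
    pointwise x with view x
    ... | ⟨ p ⟩ = same p

  coronaSubset : Subset n → Subset n → Subset (n + n * m)
  coronaSubset B L = B ++ concat (map (replicate m) L)

  lookup-coronaSubset-base : ∀ B L i → lookup (coronaSubset B L) (enc (base i)) ≡ lookup B i
  lookup-coronaSubset-base B L i = lookup-++ˡ B _ i

  lookup-coronaSubset-leaf : ∀ B L i a → lookup (coronaSubset B L) (enc (leaf i a)) ≡ lookup L i
  lookup-coronaSubset-leaf B L i a = begin
    lookup (B ++ concat (map (replicate m) L)) (n ↑ʳ combine i a) ≡⟨ lookup-++ʳ B _ (combine i a) ⟩
    lookup (concat (map (replicate m) L)) (combine i a)          ≡⟨ lookup-concat (map (replicate m) L) i a ⟩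
    lookup (lookup (map (replicate m) L) i) a                    ≡⟨ cong (λ xs → lookup xs a) (lookup-map i (replicate m) L) ⟩
    lookup (replicate m (lookup L i)) a                          ≡⟨ lookup-replicate a (lookup L i) ⟩
    lookup L i                                                   ∎
    where open ≡-Reasoning

  ∈coronaSubset-base : ∀ {B L i} → i ∈ B → enc (base i) ∈ coronaSubset B L
  ∈coronaSubset-base {B} {L} {i} = ∈-resp-lookup (sym (lookup-coronaSubset-base B L i))

  ∈coronaSubset-leaf : ∀ {B L i a} → i ∈ L → enc (leaf i a) ∈ coronaSubset B L
  ∈coronaSubset-leaf {B} {L} {i} {a} = ∈-resp-lookup (sym (lookup-coronaSubset-leaf B L i a))

  baseOf : Subset (n + n * m) → Subset n
  baseOf T = tabulate (λ i → lookup T (enc (base i)))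

  base∈⇒∈baseOf : ∀ {T i} → enc (base i) ∈ T → i ∈ baseOf T
  base∈⇒∈baseOf {i = i} = ∈-resp-lookup (sym (lookup∘tabulate _ i))

  leaf∈⇒∈U : ∀ {T i a} → enc (leaf i a) ∈ T → i ∈ U {n} {m} T
  leaf∈⇒∈U {T} {i} {a} leaf∈T = lookup⇒[]= i (U T) (trans (lookup∘tabulate _ i)
    (Equivalence.to T-≡ (any⁺ _ (lose (∈-allFin a) (Equivalence.from T-≡ ([]=⇒lookup leaf∈T))))))

  ∈U⇒leaf∈ : ∀ {T i} → i ∈ U {n} {m} T → ∃[ a ] enc (leaf i a) ∈ T
  ∈U⇒leaf∈ {T} {i} i∈U with satisfied (any⁻ _ (allFin m)
                                (Equivalence.from T-≡ (trans (sym (lookup∘tabulate _ i)) ([]=⇒lookup i∈U))))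
  ... | a , leaf∈T = a , lookup⇒[]= _ T (Equivalence.to T-≡ leaf∈T)

  CopyClosed : Subset (n + n * m) → Set
  CopyClosed T = ∀ i → (∀ a → enc (leaf i a) ∉ T) ⊎ (∀ a → enc (leaf i a) ∈ T)

  copyClosed⇒≡coronaSubset : ∀ {T} → CopyClosed T → T ≡ coronaSubset (baseOf T) (U T)
  copyClosed⇒≡coronaSubset {T} closed = enc-ext λ where
      (base i) → sym (trans (lookup-coronaSubset-base (baseOf T) (U T) i) (lookup∘tabulate _ i))
      (leaf i a) → trans (lookup-leaf i a) (sym (lookup-coronaSubset-leaf (baseOf T) (U T) i a))
    where
    lookup-leaf : ∀ i a → lookup T (enc (leaf i a)) ≡ lookup (U T) i
    lookup-leaf i a with closed i
    ... | inj₁ none = trans (∉⇒lookup≡false (none a)) (sym (∉⇒lookup≡false λ i∈U → none _ (proj₂ (∈U⇒leaf∈ i∈U))))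
    ... | inj₂ all = trans ([]=⇒lookup (all a)) (sym ([]=⇒lookup (leaf∈⇒∈U (all a))))

  ∣coronaSubset∣ : ∀ (B L : Subset n) → ∣ coronaSubset B L ∣ ≡ ∣ B ∣ + m * ∣ L ∣
  ∣coronaSubset∣ B L = trans (∣p++q∣≡∣p∣+∣q∣ B _) (cong (∣ B ∣ +_) (∣concat-replicate∣ m L))

module Corona {n m : ℕ} (G : Graph n) (H : Graph m) where

  open CoronaVertices n m

  G⊙H : Fin (n + n * m) → Fin (n + n * m) → Bool
  G⊙H = coronaAdj G H

  cadj : Vertex → Vertex → Bool
  cadj (base i) (base j) = adj G i j
  cadj (base i) (leaf j _) = ⌊ i ≟ j ⌋
  cadj (leaf i _) (base j) = ⌊ i ≟ j ⌋
  cadj (leaf i a) (leaf j b) = ⌊ i ≟ j ⌋ ∧ adj H a b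

  G⊙H≡cadj : ∀ x y → G⊙H x y ≡ cadj (dec x) (dec y)
  G⊙H≡cadj x y with splitAt n x | splitAt n y
  ... | inj₁ i | inj₁ j = refl
  ... | inj₁ i | inj₂ l = refl
  ... | inj₂ k | inj₁ j = refl
  ... | inj₂ k | inj₂ l = refl

  data Edge : Vertex → Vertex → Set where
    base-base : ∀ {i j} → T (adj G i j) → Edge (base i) (base j)
    base-leaf : ∀ {i a} → Edge (base i) (leaf i a)
    leaf-base : ∀ {i a} → Edge (leaf i a) (base i)
    leaf-leaf : ∀ {i a b} → T (adj H a b) → Edge (leaf i a) (leaf i b)

  cadj⇒Edge : ∀ p q → T (cadj p q) → Edge p q
  cadj⇒Edge (base i) (base j) e = base-base e
  cadj⇒Edge (base i) (leaf j a) e with toWitness e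
  ... | refl = base-leaf
  cadj⇒Edge (leaf i a) (base j) e with toWitness e
  ... | refl = leaf-base
  cadj⇒Edge (leaf i a) (leaf j b) e with Equivalence.to T-∧ e
  ... | i≟j , e′ with toWitness {a? = i ≟ j} i≟j
  ...   | refl = leaf-leaf e′

  Edge⇒cadj : ∀ {p q} → Edge p q → T (cadj p q)
  Edge⇒cadj (base-base e) = e
  Edge⇒cadj base-leaf = fromWitness refl
  Edge⇒cadj leaf-base = fromWitness refl
  Edge⇒cadj (leaf-leaf e) = Equivalence.from T-∧ (fromWitness refl , e)

  edge : ∀ {x y} → T (G⊙H x y) → Edge (dec x) (dec y)
  edge {x} {y} e = cadj⇒Edge _ _ (subst T (G⊙H≡cadj x y) e)

  edge⁻¹ : ∀ {p q} → Edge p q → T (G⊙H (enc p) (enc q))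
  edge⁻¹ {p} {q} e = subst T (sym (trans (G⊙H≡cadj (enc p) (enc q)) (cong₂ cadj (dec-enc p) (dec-enc q))))
                             (Edge⇒cadj e)

  -- Dropping the vertices of the copies of H from a walk leaves a walk in G; entering or
  -- leaving a copy costs one step each.
  Projected : Vertex → Vertex → ℕ → Set
  Projected p q k = root p ≡ root q ⊎ ∃[ d ] (Walk (adj G) (root p) (root q) d × depth p + d + depth q ≤ k)

  project-step : ∀ {p r q k} → Edge p r → depth q ≤ depth r + k → Projected r q k → Projected p q (suc k)
  project-step (base-base e) q≤k (inj₁ refl) = inj₂ (1 , step e here , s≤s q≤k)
  project-step (base-base e) _ (inj₂ (d , w , ≤k)) = inj₂ (suc d , step e w , s≤s ≤k)
  project-step base-leaf _ (inj₁ same) = inj₁ same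
  project-step base-leaf _ (inj₂ (d , w , ≤k)) = inj₂ (d , w , m≤n⇒m≤1+n (≤-trans (n≤1+n _) ≤k))
  project-step leaf-base _ (inj₁ same) = inj₁ same
  project-step leaf-base _ (inj₂ (d , w , ≤k)) = inj₂ (d , w , s≤s ≤k)
  project-step (leaf-leaf _) _ (inj₁ same) = inj₁ same
  project-step (leaf-leaf _) _ (inj₂ (d , w , ≤k)) = inj₂ (d , w , m≤n⇒m≤1+n ≤k)

  depth-bound : ∀ {x y k} → Walk G⊙H x y k → depth (dec y) ≤ depth (dec x) + k
  depth-bound {x} here = m≤m+n (depth (dec x)) 0
  depth-bound {x} {y} (step {k = k} _ _) = ≤-trans (depth≤1 (dec y)) (≤-trans (s≤s z≤n) (m≤n+m (suc k) (depth (dec x))))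

  project : ∀ {x y k} → Walk G⊙H x y k → Projected (dec x) (dec y) k
  project here = inj₁ refl
  project (step e w) = project-step (edge e) (depth-bound w) (project w)

  project-enc : ∀ {p q k} → Walk G⊙H (enc p) (enc q) k → Projected p q k
  project-enc {p} {q} {k} w = subst₂ (λ p q → Projected p q k) (dec-enc p) (dec-enc q) (project w)

  lift-base : ∀ {i j d} → Walk (adj G) i j d → Walk G⊙H (enc (base i)) (enc (base j)) d
  lift-base here = here
  lift-base (step e w) = step (edge⁻¹ (base-base e)) (lift-base w)

  to-root : ∀ p → Walk G⊙H (enc p) (enc (base (root p))) (depth p)
  to-root (base i) = here
  to-root (leaf i a) = step (edge⁻¹ leaf-base) here

  from-root : ∀ p → Walk G⊙H (enc (base (root p))) (enc p) (depth p)
  from-root (base i) = here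
  from-root (leaf i a) = step (edge⁻¹ base-leaf) here

  lift : ∀ {p q d} → Walk (adj G) (root p) (root q) d → Walk G⊙H (enc p) (enc q) (depth p + d + depth q)
  lift {p} {q} w = subst (Walk _ _ _) (sym (+-assoc (depth p) _ (depth q)))
                         (to-root p ++ʷ (lift-base w ++ʷ from-root q))

  Dist-lift : ∀ {p q d} → root p ≢ root q → Dist (adj G) (root p) (root q) d →
              Dist G⊙H (enc p) (enc q) (depth p + d + depth q)
  Dist-lift {p} {q} {d} p≁q (w , w-min) = lift {p} {q} w , shortest
    where
    shortest : ∀ k → Walk G⊙H (enc p) (enc q) k → depth p + d + depth q ≤ k
    shortest k w′ with project-enc {p} {q} w′
    ... | inj₁ p∼q = contradiction p∼q p≁q
    ... | inj₂ (d′ , w″ , ≤k) = ≤-trans (+-monoˡ-≤ (depth q) (+-monoʳ-≤ (depth p) (w-min d′ w″))) ≤k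

  Dist-project : ∀ {p q e} → root p ≢ root q → Dist G⊙H (enc p) (enc q) e →
                 ∃[ d ] (Dist (adj G) (root p) (root q) d × e ≡ depth p + d + depth q)
  Dist-project {p} {q} p≁q (w , w-min) with project-enc {p} {q} w
  ... | inj₁ p∼q = contradiction p∼q p≁q
  ... | inj₂ (d , w′ , ≤e) = d , (w′ , shortest) , ≤-antisym (w-min _ (lift {p} {q} w′)) ≤e
    where
    shortest : ∀ j → Walk (adj G) (root p) (root q) j → d ≤ j
    shortest j w″ = +-cancelˡ-≤ (depth p) d j (+-cancelʳ-≤ (depth q) _ _ (≤-trans ≤e (w-min _ (lift {p} {q} w″))))

  Dist-project-≥ : ∀ {p q e} → root p ≢ root q → Dist G⊙H (enc p) (enc q) e → depth p + 1 + depth q ≤ e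
  Dist-project-≥ {p} {q} p≁q D with Dist-project {p} {q} p≁q D
  ... | zero , (w , _) , _ = contradiction (walk-zero⇒≡ w) p≁q
  ... | suc d , _ , refl = +-monoˡ-≤ (depth q) (+-monoʳ-≤ (depth p) (s≤s z≤n))

  Dist-base-leaf : ∀ {i a} → Dist G⊙H (enc (base i)) (enc (leaf i a)) 1
  Dist-base-leaf = Dist-adjacent (λ e → case enc-injective {base _} {leaf _ _} e of λ ()) (edge⁻¹ base-leaf)

  Dist-leaf-base : ∀ {i a} → Dist G⊙H (enc (leaf i a)) (enc (base i)) 1
  Dist-leaf-base = Dist-adjacent (λ e → case enc-injective {leaf _ _} {base _} e of λ ()) (edge⁻¹ leaf-base)

  equidist-project : ∀ {r p q} → root r ≢ root p → root r ≢ root q → Equidist G⊙H (enc r) (enc p) (enc q) →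
    ∃₂ λ d₁ d₂ → Dist (adj G) (root r) (root p) d₁ × Dist (adj G) (root r) (root q) d₂ × d₁ + depth p ≡ d₂ + depth q
  equidist-project {r} {p} {q} r≁p r≁q (k , Dp , Dq) with Dist-project {r} {p} r≁p Dp | Dist-project {r} {q} r≁q Dq
  ... | d₁ , D₁ , k≡₁ | d₂ , D₂ , k≡₂ = d₁ , d₂ , D₁ , D₂ , +-cancelˡ-≡ (depth r) _ _ (begin
      depth r + (d₁ + depth p) ≡⟨ +-assoc (depth r) d₁ _ ⟨
      depth r + d₁ + depth p   ≡⟨ k≡₁ ⟨
      k                        ≡⟨ k≡₂ ⟩
      depth r + d₂ + depth q   ≡⟨ +-assoc (depth r) d₂ _ ⟩
      depth r + (d₂ + depth q) ∎)
    where open ≡-Reasoning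

  extension-equalizes : Connected G → ∀ {C} → IsVertexCover (BisAdj G) C →
                        IsDistEqualizer G⊙H (coronaSubset ⊤ C)
  extension-equalizes connected {C} C-covers x y _ x∉ y∉ with view x | view y
  ... | ⟨ base i ⟩ | _ = contradiction (∈coronaSubset-base {L = C} ∈⊤) x∉
  ... | ⟨ leaf i a ⟩ | ⟨ base j ⟩ = contradiction (∈coronaSubset-base {L = C} ∈⊤) y∉
  ... | ⟨ leaf i a ⟩ | ⟨ leaf j b ⟩ with i ≟ j
  ...   | yes refl = enc (base i) , ∈coronaSubset-base {L = C} ∈⊤ , 1 , Dist-base-leaf , Dist-base-leaf
  ...   | no i≢j with any? (λ w → equidistant? (adj G) connected w i j)
  ...     | yes (w , k , Di , Dj) =
    enc (base w) , ∈coronaSubset-base {L = C} ∈⊤ , k + 1 ,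
    Dist-lift {base w} {leaf i a} (equidistant⇒≢ i≢j Di Dj) Di ,
    Dist-lift {base w} {leaf j b} (equidistant⇒≢ (i≢j ∘ sym) Dj Di) Dj
  ...     | no no-equalizer with C-covers i j (i≢j , no-equalizer)
  ...       | inj₁ i∈C = contradiction (∈coronaSubset-leaf {B = ⊤} i∈C) x∉
  ...       | inj₂ j∈C = contradiction (∈coronaSubset-leaf {B = ⊤} j∈C) y∉

module Equalizer {n m : ℕ} {G : Graph n} {H : Graph m} (S : Subset (n + n * m))
                 (S-equalizes : IsDistEqualizer (coronaAdj G H) S) (a₀ : Fin m) where

  open CoronaVertices n m
  open Corona G H

  US : Subset n
  US = U {n} {m} S

  Sᴳ : Subset n
  Sᴳ = baseOf S

  ∉U⇒leaf∉S : ∀ {i a} → i ∉ US → enc (leaf i a) ∉ S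
  ∉U⇒leaf∉S i∉U = i∉U ∘ leaf∈⇒∈U

  ∉Sᴳ⇒base∉S : ∀ {i} → i ∉ Sᴳ → enc (base i) ∉ S
  ∉Sᴳ⇒base∉S i∉Sᴳ = i∉Sᴳ ∘ base∈⇒∈baseOf

  equalizer : ∀ p q → p ≢ q → enc p ∉ S → enc q ∉ S → ∃[ r ] (enc r ∈ S × Equidist G⊙H (enc r) (enc p) (enc q))
  equalizer p q p≢q p∉S q∉S with S-equalizes (enc p) (enc q) (p≢q ∘ enc-injective) p∉S q∉S
  ... | w , w∈S , equidistant with view w
  ...   | ⟨ r ⟩ = r , w∈S , equidistant

  copy-disjoint-from-S : ∀ {i} r → i ∉ US → i ∉ Sᴳ → root r ≡ i → enc r ∉ S
  copy-disjoint-from-S (base i) _ i∉Sᴳ refl = ∉Sᴳ⇒base∉S i∉Sᴳ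
  copy-disjoint-from-S (leaf i _) i∉U _ refl = ∉U⇒leaf∉S i∉U

  leaf-mate-unequalizing : ∀ {i j a b} r → i ∉ US → i ≢ j → enc r ∈ S → root r ≡ i →
                           ¬ Equidist G⊙H (enc r) (enc (leaf i a)) (enc (leaf j b))
  leaf-mate-unequalizing (leaf i _) i∉U _ r∈S refl _ = ∉U⇒leaf∉S i∉U r∈S
  leaf-mate-unequalizing (base i) _ i≢j _ refl (k , D₁ , D₂) with Dist-unique D₁ Dist-base-leaf
  ... | refl with Dist-project-≥ {base i} {leaf _ _} i≢j D₂
  ...   | s≤s ()

  base-mate-unequalizing : ∀ {i} r q → i ∉ Sᴳ → i ≢ root q → enc r ∈ S → root r ≡ i →
                           ¬ Equidist G⊙H (enc r) (enc (base i)) (enc q)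
  base-mate-unequalizing (base i) _ i∉Sᴳ _ r∈S refl _ = ∉Sᴳ⇒base∉S i∉Sᴳ r∈S
  base-mate-unequalizing (leaf i c) q _ i≁q _ refl (k , D₁ , D₂) with Dist-unique D₁ Dist-leaf-base
  ... | refl with Dist-project-≥ {leaf i c} {q} i≁q D₂
  ...   | s≤s ()

  -- Every vertex outside the copy of v_i is one step farther from H_i than from v_i.
  U-or-Sᴳ : ∀ i → i ∈ US ⊎ i ∈ Sᴳ
  U-or-Sᴳ i with i ∈? US | i ∈? Sᴳ
  ... | yes i∈U | _ = inj₁ i∈U
  ... | no _ | yes i∈Sᴳ = inj₂ i∈Sᴳ
  ... | no i∉U | no i∉Sᴳ with equalizer (base i) (leaf i a₀) (λ ()) (∉Sᴳ⇒base∉S i∉Sᴳ) (∉U⇒leaf∉S i∉U)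
  ...   | r , r∈S , equidistant with root r ≟ i
  ...     | yes r∼i = contradiction r∈S (copy-disjoint-from-S r i∉U i∉Sᴳ r∼i)
  ...     | no r≁i with equidist-project {r} {base i} {leaf i a₀} r≁i r≁i equidistant
  ...       | d₁ , d₂ , D₁ , D₂ , d₁+0≡d₂+1 with Dist-unique D₁ D₂
  ...         | refl = case +-cancelˡ-≡ d₁ 0 1 d₁+0≡d₂+1 of λ ()

  U∪Sᴳ≡⊤ : US ∪ Sᴳ ≡ ⊤
  U∪Sᴳ≡⊤ = ⊆-antisym ⊆⊤ (λ {i} _ → x∈p∪q⁺ (U-or-Sᴳ i))

  U-covers : IsVertexCover (BisAdj G) US
  U-covers i j (i≢j , no-equalizer) with i ∈? US | j ∈? US
  ... | yes i∈U | _ = inj₁ i∈U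
  ... | no _ | yes j∈U = inj₂ j∈U
  ... | no i∉U | no j∉U with equalizer (leaf i a₀) (leaf j a₀) (i≢j ∘ cong root) (∉U⇒leaf∉S i∉U) (∉U⇒leaf∉S j∉U)
  ...   | r , r∈S , equidistant with root r ≟ i | root r ≟ j
  ...     | yes r∼i | _ = ⊥-elim (leaf-mate-unequalizing r i∉U i≢j r∈S r∼i equidistant)
  ...     | no _ | yes r∼j = ⊥-elim (leaf-mate-unequalizing r j∉U (i≢j ∘ sym) r∈S r∼j (Equidist-sym equidistant))
  ...     | no r≁i | no r≁j with equidist-project {r} {leaf i a₀} {leaf j a₀} r≁i r≁j equidistant
  ...       | d₁ , d₂ , D₁ , D₂ , d₁+1≡d₂+1 with +-cancelʳ-≡ 1 d₁ d₂ d₁+1≡d₂+1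
  ...         | refl = ⊥-elim (no-equalizer (root r , d₁ , D₁ , D₂))

  Sᴳ-covers : IsVertexCover (BisAdj G) Sᴳ
  Sᴳ-covers i j (i≢j , no-equalizer) with i ∈? Sᴳ | j ∈? Sᴳ
  ... | yes i∈Sᴳ | _ = inj₁ i∈Sᴳ
  ... | no _ | yes j∈Sᴳ = inj₂ j∈Sᴳ
  ... | no i∉Sᴳ | no j∉Sᴳ with equalizer (base i) (base j) (i≢j ∘ cong root) (∉Sᴳ⇒base∉S i∉Sᴳ) (∉Sᴳ⇒base∉S j∉Sᴳ)
  ...   | r , r∈S , equidistant with root r ≟ i | root r ≟ j
  ...     | yes r∼i | _ = ⊥-elim (base-mate-unequalizing r (base j) i∉Sᴳ i≢j r∈S r∼i equidistant)
  ...     | no _ | yes r∼j =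
    ⊥-elim (base-mate-unequalizing r (base i) j∉Sᴳ (i≢j ∘ sym) r∈S r∼j (Equidist-sym equidistant))
  ...     | no r≁i | no r≁j with equidist-project {r} {base i} {base j} r≁i r≁j equidistant
  ...       | d₁ , d₂ , D₁ , D₂ , d₁+0≡d₂+0 with +-cancelʳ-≡ 0 d₁ d₂ d₁+0≡d₂+0
  ...         | refl = ⊥-elim (no-equalizer (root r , d₁ , D₁ , D₂))

  ForwardWitness : Fin n → Fin n → Set
  ForwardWitness u v = ∃[ w ] ∃[ k ] (Dist (adj G) w u (suc k) × Dist (adj G) w v k)

  leaf-mate-forward : ∀ {u v} r → v ∉ US → u ≢ v → enc r ∈ S → root r ≡ v →
                      Equidist G⊙H (enc r) (enc (base u)) (enc (leaf v a₀)) → ForwardWitness u v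
  leaf-mate-forward (leaf v _) v∉U _ r∈S refl _ = ⊥-elim (∉U⇒leaf∉S v∉U r∈S)
  leaf-mate-forward {u} (base v) _ u≢v _ refl (k , D₁ , D₂) with Dist-unique D₂ Dist-base-leaf
  ... | refl with Dist-project {base v} {base u} (u≢v ∘ sym) D₁
  ...   | d , D , 1≡d+0 = v , 0 , subst (Dist (adj G) v u) (trans (sym (+-identityʳ d)) (sym 1≡d+0)) D , Dist-refl

  forward-witness : ∀ {u v} → u ∉ Sᴳ → v ∉ US → u ≢ v → ForwardWitness u v
  forward-witness {u} {v} u∉Sᴳ v∉U u≢v
    with equalizer (base u) (leaf v a₀) (λ ()) (∉Sᴳ⇒base∉S u∉Sᴳ) (∉U⇒leaf∉S v∉U)
  ... | r , r∈S , equidistant with root r ≟ u | root r ≟ v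
  ...   | yes r∼u | _ = ⊥-elim (base-mate-unequalizing r (leaf v a₀) u∉Sᴳ u≢v r∈S r∼u equidistant)
  ...   | no _ | yes r∼v = leaf-mate-forward r v∉U u≢v r∈S r∼v equidistant
  ...   | no r≁u | no r≁v with equidist-project {r} {base u} {leaf v a₀} r≁u r≁v equidistant
  ...     | d₁ , d₂ , D₁ , D₂ , d₁+0≡d₂+1 =
    root r , d₂ , subst (Dist (adj G) (root r) u) (trans (sym (+-identityʳ d₁)) (trans d₁+0≡d₂+1 (+-comm d₂ 1))) D₁ , D₂

  forward-equalized : ForwardEqualized G US Sᴳ
  forward-equalized = U∪Sᴳ≡⊤ , λ u v u∈U─Sᴳ v∈Sᴳ─U →
    forward-witness (x∈p─q⇒x∉q US Sᴳ u∈U─Sᴳ) (x∈p─q⇒x∉q Sᴳ US v∈Sᴳ─U)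
                    (λ { refl → x∈p─q⇒x∉q US Sᴳ u∈U─Sᴳ (p─q⊆p Sᴳ US v∈Sᴳ─U) })

  ∣U∩Sᴳ∣+n≡∣U∣+∣Sᴳ∣ : ∣ US ∩ Sᴳ ∣ + n ≡ ∣ US ∣ + ∣ Sᴳ ∣
  ∣U∩Sᴳ∣+n≡∣U∣+∣Sᴳ∣ = begin
    ∣ US ∩ Sᴳ ∣ + n           ≡⟨ cong (∣ US ∩ Sᴳ ∣ +_) (sym (trans (cong ∣_∣ U∪Sᴳ≡⊤) (∣⊤∣≡n n))) ⟩
    ∣ US ∩ Sᴳ ∣ + ∣ US ∪ Sᴳ ∣ ≡⟨ ∣p∩q∣+∣p∪q∣≡∣p∣+∣q∣ US Sᴳ ⟩
    ∣ US ∣ + ∣ Sᴳ ∣           ∎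
    where open ≡-Reasoning

  size-bound : Connected G → (∀ T → IsDistEqualizer G⊙H T → ∣ S ∣ ≤ ∣ T ∣) → CopyClosed S →
               ∀ {C} → IsVertexCover (BisAdj G) C → ∣ Sᴳ ∣ + m * ∣ US ∣ ≤ n + m * ∣ C ∣
  size-bound connected S-minimum closed {C} C-covers = begin
    ∣ Sᴳ ∣ + m * ∣ US ∣       ≡⟨ ∣coronaSubset∣ Sᴳ US ⟨
    ∣ coronaSubset Sᴳ US ∣    ≡⟨ cong ∣_∣ (copyClosed⇒≡coronaSubset closed) ⟨
    ∣ S ∣                     ≤⟨ S-minimum _ (extension-equalizes connected C-covers) ⟩
    ∣ coronaSubset ⊤ C ∣      ≡⟨ ∣coronaSubset∣ ⊤ C ⟩
    ∣ ⊤ {n} ∣ + m * ∣ C ∣     ≡⟨ cong (_+ m * ∣ C ∣) (∣⊤∣≡n n) ⟩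
    n + m * ∣ C ∣             ∎
    where open ≤-Reasoning

proposition29 : ∀ {n m : ℕ} (G : Graph n) (H : Graph m) → Connected G →
    (S : Subset (n + n * m)) → IsMinDistEqualizer (coronaAdj G H) S →
    (∀ (i : Fin n) → (∀ (a : Fin m) → hVtx i a ∉ S) ⊎ (∀ (a : Fin m) → hVtx i a ∈ S)) →
    (α β β* : ℕ) → IsIndependenceNumber (BisAdj G) α → IsVertexCoverNumber (BisAdj G) β →
    IsBetaStar G β* → α ⊓ (β ∸ β* + 1) < m →
    IsVertexCover (BisAdj G) (U {n} {m} S) × ∣ U {n} {m} S ∣ ≡ β
proposition29 {n} {m} G H connected S (S-equalizes , S-minimum) closed α β β*
              (_ , α-maximum) ((C , C-covers , refl) , β-minimum) (_ , β*-minimum) min<m =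
  U-covers , ≤-antisym ∣U∣≤∣C∣ (β-minimum US U-covers)
  where
  open Equalizer {G = G} {H} S S-equalizes (fromℕ< (≤-<-trans z≤n min<m))

  ∣U∣≤∣C∣ : ∣ US ∣ ≤ ∣ C ∣
  ∣U∣≤∣C∣ = excess-bound
    (size-bound connected S-minimum closed C-covers)
    ∣U∩Sᴳ∣+n≡∣U∣+∣Sᴳ∣
    (subst (_≤ α) (∣∁p∣≡n∸∣p∣ Sᴳ) (α-maximum _ (∁-of-cover-independent Sᴳ-covers)))
    (β*-minimum US Sᴳ (U-covers , Sᴳ-covers , forward-equalized))
    min<m
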